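{- Let $N\geq 1$, $q$ a prime power, and let $\mathcal{L}$ be a higgledy-piggledy line set of $\mathrm{PG}(N,q)$ with $|\mathcal{L}|=N+\lfloor N/2\rfloor\leq q$. Then: (1) if $N$ is odd, the lines of $\mathcal{L}$ are pairwise disjoint; (2) if $N\geq 4$ is even, at most two lines of $\mathcal{L}$ intersect (i.e. there is at most one unordered pair of distinct lines of $\mathcal{L}$ that meet).
   Context: $\mathrm{PG}(N,q)$ denotes the Desarguesian projective space of dimension $N$ over $\mathbb{F}_q$. A set $\mathcal{L}$ of lines is higgledy-piggledy if the set of points lying on at least one line of $\mathcal{L}$ meets every $(N-1)$-dimensional subspace (hyperplane) $\kappa$ in a set of points spanning $\kappa$. -}

module Defs where

open import Data.Nat using (ℕ; zero; suc; _^_)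
open import Data.Fin using (Fin)
open import Data.Product using (Σ; _×_; ∃; ∃-syntax)
open import Data.Nat.Primality using (Prime)
open import Relation.Binary.PropositionalEquality using (_≡_)
open import Relation.Nullary using (¬_)
open import Algebra.Structures using (IsCommutativeRing)

IsPrimePower : ℕ → Set
IsPrimePower q = Σ ℕ λ p → Σ ℕ λ k → Prime p × q ≡ p ^ suc k

record Field : Set₁ where
  infixl 6 _+_
  infixl 7 _*_
  field
    Carrier : Set
    _+_ _*_ : Carrier → Carrier → Carrier
    -_ : Carrier → Carrier
    0# 1# : Carrier
    isCommutativeRing : IsCommutativeRing _≡_ _+_ _*_ -_ 0# 1#
    0≢1 : ¬ (0# ≡ 1#)
    inverse : ∀ x → ¬ (x ≡ 0#) → Σ Carrier λ y → x * y ≡ 1#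

-- Projective geometry PG(N,F) in homogeneous coordinates F^(N+1).
module Geometry (F : Field) (N : ℕ) where
  open Field F

  V : Set
  V = Fin (suc N) → Carrier

  ∑ : {k : ℕ} → (Fin k → Carrier) → Carrier
  ∑ {zero} f = 0#
  ∑ {suc k} f = f Fin.zero + ∑ (λ i → f (Fin.suc i))

  NonZero : V → Set
  NonZero x = ¬ (∀ i → x i ≡ 0#)

  IsComb2 : Carrier → V → Carrier → V → V → Set
  IsComb2 a u b v x = ∀ i → x i ≡ a * u i + b * v i

  record Line : Set where
    field
      u v : V
      independent : ∀ a b → (∀ i → a * u i + b * v i ≡ 0#) → a ≡ 0# × b ≡ 0#

  InSpan : Line → V → Set
  InSpan ℓ x = Σ Carrier λ a → Σ Carrier λ b → IsComb2 a (Line.u ℓ) b (Line.v ℓ) x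

  SameLine : Line → Line → Set
  SameLine ℓ m = (∀ x → InSpan ℓ x → InSpan m x) × (∀ x → InSpan m x → InSpan ℓ x)

  Meet : Line → Line → Set
  Meet ℓ m = Σ V λ x → NonZero x × InSpan ℓ x × InSpan m x

  -- a hyperplane is given by a nonzero linear form c, points x with c·x = 0
  dot : V → V → Carrier
  dot c x = ∑ (λ i → c i * x i)

  InHyperplane : V → V → Set
  InHyperplane c x = dot c x ≡ 0#

  Covered : {m : ℕ} → (Fin m → Line) → V → Set
  Covered L x = NonZero x × ∃[ i ] InSpan (L i) x

  -- higgledy-piggledy: for every hyperplane κ, the covered points of κ span κ
  HiggledyPiggledy : {m : ℕ} → (Fin m → Line) → Set
  HiggledyPiggledy L =
    ∀ (c : V) → NonZero c →
    ∀ (y : V) → InHyperplane c y →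
    Σ ℕ λ k → Σ (Fin k → V) λ w →
      (∀ j → Covered L (w j) × InHyperplane c (w j)) ×
      Σ (Fin k → Carrier) λ λs → ∀ i → y i ≡ ∑ (λ j → λs j * w j i)

-- Suppose a codimension-2 subspace Π meets every line of a higgledy-piggledy set of at most q lines.
-- A line not contained in Π lies in at most one of the q + 1 hyperplanes through Π, so one of these
-- hyperplanes, H, contains no line outside Π.  A line not in H meets H only in its point on Π, hence
-- all covered points of H lie in Π and cannot span H: a contradiction.
-- Each forbidden intersection pattern produces such a Π = {c₁·x = c₂·x = 0} by linear algebra: c₁
-- vanishes on the intersection points and contains s of the other lines, c₂ vanishes on those points
-- and on the traces on c₁ of the remaining r lines.  With N + ⌊N/2⌋ lines, one meeting pair (N odd),
-- or two meeting pairs or one line meeting two others (N even), leaves just enough room for both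
-- homogeneous systems to have fewer equations than the N + 1 unknowns.

module Submission where

open import Defs
open import Algebra.Bundles using (CommutativeRing)
open import Algebra.Structures using (IsCommutativeRing)
open import Data.Empty using (⊥-elim)
open import Data.Fin as Fin using (Fin; zero; suc; _↑ˡ_; _↑ʳ_)
open import Data.Fin.Properties
  using (all?; any?; join-splitAt; 0≢1+n; suc-injective; punchIn-punchOut; punchOut-injective; pigeonhole; <⇒≢)
open import Data.Nat as ℕ using (ℕ; zero; suc)
open import Data.Product using (Σ; ∃; _×_; _,_; proj₁; proj₂)
open import Data.Sum using (_⊎_; inj₁; inj₂)
open import Data.Vec using (Vec; _∷_; []; lookup)
open import Data.Vec.Functional using (_++_)
open import Data.Vec.Functional.Relation.Unary.All using (All)
open import Data.Vec.Functional.Relation.Unary.All.Properties using (++⁻)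
open import Data.Vec.Relation.Unary.All using (_∷_; [])
open import Data.Vec.Relation.Unary.AllPairs using (_∷_; [])
open import Data.Vec.Relation.Unary.Unique.Propositional using (Unique)
open import Data.Vec.Relation.Unary.Unique.Propositional.Properties using (lookup-injective)
open import Function using (id; _∘_)
open import Function.Bundles using (_↔_; Inverse; Injection)
open import Function.Definitions using (Injective)
open import Function.Properties.Inverse using (↔⇒↣; ↔-sym)
open import Relation.Binary.Definitions using (DecidableEquality)
open import Relation.Binary.PropositionalEquality
open import Relation.Nullary using (¬_; Dec; yes; no; contradiction; ¬?)
open import Relation.Nullary.Decidable using (decidable-stable; _×-dec_; via-injection)

module LinearAlgebra (F : Field) (_≟_ : DecidableEquality (Field.Carrier F)) where
  open Field F public
  open IsCommutativeRing isCommutativeRing public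
    using ( +-comm; -‿inverseʳ; +-identityˡ; +-identityʳ; distribˡ
          ; *-comm; *-assoc; *-identityˡ; *-identityʳ; zeroˡ; zeroʳ )

  commutativeRing : CommutativeRing _ _
  commutativeRing = record { isCommutativeRing = isCommutativeRing }

  open CommutativeRing commutativeRing using (ring; semiring; commutativeSemiring)
  open import Algebra.Properties.Ring ring public
    using (+-cancelˡ; +-cancelʳ; x∙y⁻¹≈ε⇒x≈y; -‿involutive; -0#≈0#; -‿distribˡ-*; -‿distribʳ-*)
  open import Algebra.Solver.Ring.NaturalCoefficients.Default commutativeSemiring public
  open import Algebra.Properties.Semiring.Sum semiring public
    using (sum; sum-cong-≗; ∑-distrib-+; ∑-comm; *-distribˡ-sum; sum-replicate-zero)
  open ≡-Reasoning

  1≢0 : ¬ 1# ≡ 0#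
  1≢0 = 0≢1 ∘ sym

  *-cancelʳ-≢0 : ∀ {x y} c → ¬ c ≡ 0# → x * c ≡ y * c → x ≡ y
  *-cancelʳ-≢0 {x} {y} c c≢0 xc≡yc with inverse c c≢0
  ... | c⁻¹ , cc⁻¹≡1 = begin
    x              ≡⟨ sym (*-identityʳ x) ⟩
    x * 1#         ≡⟨ cong (x *_) (sym cc⁻¹≡1) ⟩
    x * (c * c⁻¹)  ≡⟨ sym (*-assoc x c c⁻¹) ⟩
    x * c * c⁻¹    ≡⟨ cong (_* c⁻¹) xc≡yc ⟩
    y * c * c⁻¹    ≡⟨ *-assoc y c c⁻¹ ⟩
    y * (c * c⁻¹)  ≡⟨ cong (y *_) cc⁻¹≡1 ⟩
    y * 1#         ≡⟨ *-identityʳ y ⟩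
    y              ∎

  x*y≡0⇒x≡0 : ∀ {x y} → ¬ y ≡ 0# → x * y ≡ 0# → x ≡ 0#
  x*y≡0⇒x≡0 {x} {y} y≢0 xy≡0 = *-cancelʳ-≢0 y y≢0 (trans xy≡0 (sym (zeroˡ y)))

  *-≢0 : ∀ {x y} → ¬ x ≡ 0# → ¬ y ≡ 0# → ¬ x * y ≡ 0#
  *-≢0 x≢0 y≢0 xy≡0 = x≢0 (x*y≡0⇒x≡0 y≢0 xy≡0)

  -x≡0⇒x≡0 : ∀ {x} → - x ≡ 0# → x ≡ 0#
  -x≡0⇒x≡0 {x} -x≡0 = begin
    x       ≡⟨ -‿involutive x ⟨
    - (- x) ≡⟨ cong -_ -x≡0 ⟩
    - 0#    ≡⟨ -0#≈0# ⟩
    0#      ∎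

  x*y-y*x≡0 : ∀ x y → x * y + - y * x ≡ 0#
  x*y-y*x≡0 x y = begin
    x * y + - y * x    ≡⟨ cong (x * y +_) (-‿distribˡ-* y x) ⟨
    x * y + - (y * x)  ≡⟨ cong (λ z → x * y + - z) (*-comm y x) ⟩
    x * y + - (x * y)  ≡⟨ -‿inverseʳ (x * y) ⟩
    0#                 ∎

  x-y*z≡0⇒x≡y*z : ∀ {x y z} → x + - y * z ≡ 0# → x ≡ y * z
  x-y*z≡0⇒x≡y*z {x} {y} {z} eq = x∙y⁻¹≈ε⇒x≈y x (y * z) (trans (cong (x +_) (-‿distribˡ-* y z)) eq)

  ≢0⊎≢0 : ∀ {x y} → ¬ (x ≡ 0# × y ≡ 0#) → ¬ x ≡ 0# ⊎ ¬ y ≡ 0#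
  ≢0⊎≢0 {x} {y} ¬both with x ≟ 0# | y ≟ 0#
  ... | no x≢0 | _      = inj₁ x≢0
  ... | yes _  | no y≢0 = inj₂ y≢0
  ... | yes x≡0 | yes y≡0 = contradiction (x≡0 , y≡0) ¬both

  proportional : ∀ {g₁ g₂ a b α β} → ¬ g₁ ≡ 0# ⊎ ¬ g₂ ≡ 0# →
                 a * g₁ + b * g₂ ≡ 0# → α * g₁ + β * g₂ ≡ 0# → a * β ≡ b * α
  proportional {g₁} {g₂} {a} {b} {α} {β} (inj₁ g₁≢0) ag≡0 αg≡0 =
    *-cancelʳ-≢0 g₁ g₁≢0 (+-cancelʳ (b * β * g₂) _ _ (begin
      a * β * g₁ + b * β * g₂  ≡⟨ solve 5 (λ a β b g₁ g₂ → a :* β :* g₁ :+ b :* β :* g₂ := β :* (a :* g₁ :+ b :* g₂))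
                                          refl a β b g₁ g₂ ⟩
      β * (a * g₁ + b * g₂)    ≡⟨ cong (β *_) ag≡0 ⟩
      β * 0#                   ≡⟨ trans (zeroʳ β) (sym (zeroʳ b)) ⟩
      b * 0#                   ≡⟨ cong (b *_) αg≡0 ⟨
      b * (α * g₁ + β * g₂)    ≡⟨ solve 5 (λ b α β g₁ g₂ → b :* (α :* g₁ :+ β :* g₂) := b :* α :* g₁ :+ b :* β :* g₂)
                                          refl b α β g₁ g₂ ⟩
      b * α * g₁ + b * β * g₂  ∎))
  proportional {g₁} {g₂} {a} {b} {α} {β} (inj₂ g₂≢0) ag≡0 αg≡0 =
    *-cancelʳ-≢0 g₂ g₂≢0 (+-cancelˡ (a * α * g₁) _ _ (begin
      a * α * g₁ + a * β * g₂  ≡⟨ solve 5 (λ a α β g₁ g₂ → a :* α :* g₁ :+ a :* β :* g₂ := a :* (α :* g₁ :+ β :* g₂))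
                                          refl a α β g₁ g₂ ⟩
      a * (α * g₁ + β * g₂)    ≡⟨ cong (a *_) αg≡0 ⟩
      a * 0#                   ≡⟨ trans (zeroʳ a) (sym (zeroʳ α)) ⟩
      α * 0#                   ≡⟨ cong (α *_) ag≡0 ⟨
      α * (a * g₁ + b * g₂)    ≡⟨ solve 5 (λ α a b g₁ g₂ → α :* (a :* g₁ :+ b :* g₂) := a :* α :* g₁ :+ b :* α :* g₂)
                                          refl α a b g₁ g₂ ⟩
      a * α * g₁ + b * α * g₂  ∎))

  proportional-annihilated : ∀ {a b α β c d} → a * β ≡ b * α → ¬ α ≡ 0# ⊎ ¬ β ≡ 0# →
                             α * c + β * d ≡ 0# → a * c + b * d ≡ 0#
  proportional-annihilated {a} {b} {α} {β} {c} {d} aβ≡bα (inj₁ α≢0) αc≡0 = x*y≡0⇒x≡0 α≢0 (begin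
    (a * c + b * d) * α      ≡⟨ solve 5 (λ a b c d α → (a :* c :+ b :* d) :* α := a :* (α :* c) :+ b :* α :* d)
                                        refl a b c d α ⟩
    a * (α * c) + b * α * d  ≡⟨ cong (λ y → a * (α * c) + y * d) aβ≡bα ⟨
    a * (α * c) + a * β * d  ≡⟨ solve 5 (λ a α β c d → a :* (α :* c) :+ a :* β :* d := a :* (α :* c :+ β :* d))
                                        refl a α β c d ⟩
    a * (α * c + β * d)      ≡⟨ cong (a *_) αc≡0 ⟩
    a * 0#                   ≡⟨ zeroʳ a ⟩
    0#                       ∎)
  proportional-annihilated {a} {b} {α} {β} {c} {d} aβ≡bα (inj₂ β≢0) αc≡0 = x*y≡0⇒x≡0 β≢0 (begin
    (a * c + b * d) * β      ≡⟨ solve 5 (λ a b c d β → (a :* c :+ b :* d) :* β := a :* β :* c :+ b :* (β :* d))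
                                        refl a b c d β ⟩
    a * β * c + b * (β * d)  ≡⟨ cong (λ y → y * c + b * (β * d)) aβ≡bα ⟩
    b * α * c + b * (β * d)  ≡⟨ solve 5 (λ b α β c d → b :* α :* c :+ b :* (β :* d) := b :* (α :* c :+ β :* d))
                                        refl b α β c d ⟩
    b * (α * c + β * d)      ≡⟨ cong (b *_) αc≡0 ⟩
    b * 0#                   ≡⟨ zeroʳ b ⟩
    0#                       ∎)

  dot : ∀ {k} → (Fin k → Carrier) → (Fin k → Carrier) → Carrier
  dot c x = sum (λ i → c i * x i)

  dot-comm : ∀ {k} (c x : Fin k → Carrier) → dot c x ≡ dot x c
  dot-comm c x = sum-cong-≗ (λ i → *-comm (c i) (x i))

  dot-+ʳ : ∀ {k} (c x y : Fin k → Carrier) → dot c (λ i → x i + y i) ≡ dot c x + dot c y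
  dot-+ʳ c x y = trans (sum-cong-≗ (λ i → distribˡ (c i) (x i) (y i)))
                       (∑-distrib-+ (λ i → c i * x i) (λ i → c i * y i))

  dot-*ʳ : ∀ {k} (c : Fin k → Carrier) a (x : Fin k → Carrier) → dot c (λ i → a * x i) ≡ a * dot c x
  dot-*ʳ c a x = begin
    sum (λ i → c i * (a * x i))  ≡⟨ sum-cong-≗ (λ i → solve 3 (λ c a x → c :* (a :* x) := a :* (c :* x))
                                                              refl (c i) a (x i)) ⟩
    sum (λ i → a * (c i * x i))  ≡⟨ *-distribˡ-sum a (λ i → c i * x i) ⟨
    a * dot c x                  ∎

  dot-linearʳ : ∀ {k} (c : Fin k → Carrier) a x b y →
                dot c (λ i → a * x i + b * y i) ≡ a * dot c x + b * dot c y
  dot-linearʳ c a x b y = trans (dot-+ʳ c _ _) (cong₂ _+_ (dot-*ʳ c a x) (dot-*ʳ c b y))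

  dot-+*ˡ : ∀ {k} (c : Fin k → Carrier) s d x → dot (λ i → c i + s * d i) x ≡ dot c x + s * dot d x
  dot-+*ˡ c s d x = begin
    dot (λ i → c i + s * d i) x      ≡⟨ dot-comm _ x ⟩
    dot x (λ i → c i + s * d i)      ≡⟨ dot-+ʳ x c _ ⟩
    dot x c + dot x (λ i → s * d i)  ≡⟨ cong₂ _+_ (dot-comm x c) (dot-*ʳ x s d) ⟩
    dot c x + s * dot x d            ≡⟨ cong (λ y → dot c x + s * y) (dot-comm x d) ⟩
    dot c x + s * dot d x            ∎

  dot-∑ʳ : ∀ {k m} (c : Fin k → Carrier) (λs : Fin m → Carrier) (w : Fin m → Fin k → Carrier) →
           dot c (λ i → sum (λ j → λs j * w j i)) ≡ sum (λ j → λs j * dot c (w j))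
  dot-∑ʳ c λs w = begin
    sum (λ i → c i * sum (λ j → λs j * w j i))    ≡⟨ sum-cong-≗ (λ i → *-distribˡ-sum (c i) (λ j → λs j * w j i)) ⟩
    sum (λ i → sum (λ j → c i * (λs j * w j i)))  ≡⟨ ∑-comm (λ i j → c i * (λs j * w j i)) ⟩
    sum (λ j → sum (λ i → c i * (λs j * w j i)))  ≡⟨ sum-cong-≗ (λ j → dot-*ʳ c (λs j) (w j)) ⟩
    sum (λ j → λs j * dot c (w j))                ∎

  dot-vanishes-on-span : ∀ {k m} (c : Fin k → Carrier) (λs : Fin m → Carrier) (w : Fin m → Fin k → Carrier) →
    (∀ j → dot c (w j) ≡ 0#) → dot c (λ i → sum (λ j → λs j * w j i)) ≡ 0#
  dot-vanishes-on-span {m = m} c λs w cw≡0 = begin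
    dot c (λ i → sum (λ j → λs j * w j i))  ≡⟨ dot-∑ʳ c λs w ⟩
    sum (λ j → λs j * dot c (w j))          ≡⟨ sum-cong-≗ (λ j → trans (cong (λs j *_) (cw≡0 j)) (zeroʳ (λs j))) ⟩
    sum {m} (λ _ → 0#)                      ≡⟨ sum-replicate-zero m ⟩
    0#                                      ∎

  δ : ∀ {k} → Fin k → Fin k → Carrier
  δ zero    zero    = 1#
  δ zero    (suc _) = 0#
  δ (suc _) zero    = 0#
  δ (suc l) (suc i) = δ l i

  dot-δ : ∀ {k} (c : Fin k → Carrier) l → dot c (δ l) ≡ c l
  dot-δ {suc k} c zero = begin
    c zero * 1# + sum (λ i → c (suc i) * 0#)  ≡⟨ cong₂ _+_ (*-identityʳ _) (sum-cong-≗ (zeroʳ ∘ c ∘ suc)) ⟩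
    c zero + sum {k} (λ _ → 0#)               ≡⟨ cong (c zero +_) (sum-replicate-zero k) ⟩
    c zero + 0#                               ≡⟨ +-identityʳ _ ⟩
    c zero                                    ∎
  dot-δ c (suc l) = begin
    c zero * 0# + dot (λ i → c (suc i)) (δ l)  ≡⟨ cong₂ _+_ (zeroʳ _) (dot-δ (λ i → c (suc i)) l) ⟩
    0# + c (suc l)                             ≡⟨ +-identityˡ _ ⟩
    c (suc l)                                  ∎

  -- Gaussian elimination of the first unknown, using a row whose first coefficient is nonzero.
  homogeneous-nontrivial : ∀ {m n} → m ℕ.≤ n → (E : Fin m → Fin (suc n) → Carrier) →
    Σ (Fin (suc n) → Carrier) λ x → (∃ λ i → ¬ x i ≡ 0#) × (∀ r → dot (E r) x ≡ 0#)
  homogeneous-nontrivial {zero} _ E = (λ _ → 1#) , (zero , 1≢0) , λ ()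
  homogeneous-nontrivial {suc m} {suc n} (ℕ.s≤s m≤n) E with any? (λ r → ¬? (E r zero ≟ 0#))
  ... | no ¬pivot = δ zero , (zero , 1≢0) , λ r →
    trans (dot-δ (E r) zero) (decidable-stable (E r zero ≟ 0#) (λ Er₀≢0 → ¬pivot (r , Er₀≢0)))
  ... | yes (p , a₀≢0) = x , (suc (proj₁ z≢0) , proj₂ z≢0) , solves
    where
    a = E p
    a₀⁻¹ = proj₁ (inverse (a zero) a₀≢0)

    eliminate : (Fin (suc (suc n)) → Carrier) → Fin (suc n) → Carrier
    eliminate b i = b (suc i) + (- (b zero * a₀⁻¹)) * a (suc i)

    reduced = homogeneous-nontrivial m≤n (λ t → eliminate (E (Fin.punchIn p t)))
    z = proj₁ reduced
    z≢0 = proj₁ (proj₂ reduced)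
    A = dot (λ i → a (suc i)) z

    x : Fin (suc (suc n)) → Carrier
    x zero    = - (a₀⁻¹ * A)
    x (suc i) = z i

    dot-x : ∀ b → dot b x ≡ dot (eliminate b) z
    dot-x b = begin
      b zero * - (a₀⁻¹ * A) + B      ≡⟨ cong (_+ B) (sym (-‿distribʳ-* (b zero) _)) ⟩
      - (b zero * (a₀⁻¹ * A)) + B    ≡⟨ cong (λ y → - y + B) (sym (*-assoc (b zero) a₀⁻¹ A)) ⟩
      - (b zero * a₀⁻¹ * A) + B      ≡⟨ cong (_+ B) (-‿distribˡ-* (b zero * a₀⁻¹) A) ⟩
      - (b zero * a₀⁻¹) * A + B      ≡⟨ +-comm _ B ⟩
      B + - (b zero * a₀⁻¹) * A      ≡⟨ dot-+*ˡ (λ i → b (suc i)) _ (λ i → a (suc i)) z ⟨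
      dot (eliminate b) z            ∎
      where B = dot (λ i → b (suc i)) z

    eliminate-pivot : dot (eliminate a) z ≡ 0#
    eliminate-pivot = begin
      dot (eliminate a) z            ≡⟨ dot-+*ˡ (λ i → a (suc i)) _ (λ i → a (suc i)) z ⟩
      A + - (a zero * a₀⁻¹) * A      ≡⟨ cong (λ y → A + - y * A) (proj₂ (inverse (a zero) a₀≢0)) ⟩
      A + - 1# * A                   ≡⟨ cong (A +_) (sym (-‿distribˡ-* 1# A)) ⟩
      A + - (1# * A)                 ≡⟨ cong (λ y → A + - y) (*-identityˡ A) ⟩
      A + - A                        ≡⟨ -‿inverseʳ A ⟩
      0#                             ∎

    solves : ∀ r → dot (E r) x ≡ 0#
    solves r with r Fin.≟ p
    ... | yes refl = trans (dot-x a) eliminate-pivot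
    ... | no r≢p = begin
      dot (E r) x                              ≡⟨ cong (λ r′ → dot (E r′) x) (punchIn-punchOut p≢r) ⟨
      dot (E (Fin.punchIn p t)) x              ≡⟨ dot-x (E (Fin.punchIn p t)) ⟩
      dot (eliminate (E (Fin.punchIn p t))) z  ≡⟨ proj₂ (proj₂ reduced) t ⟩
      0#                                       ∎
      where
      p≢r = r≢p ∘ sym
      t = Fin.punchOut p≢r

module LinesAndAxes (F : Field) (_≟_ : DecidableEquality (Field.Carrier F)) (N : ℕ) where
  open LinearAlgebra F _≟_
  open Geometry F N using (V; Line; InSpan; NonZero; Meet)
  open Line
  open ≡-Reasoning

  ∑≡sum : ∀ {k} (f : Fin k → Carrier) → Geometry.∑ F N f ≡ sum f
  ∑≡sum {zero} f = refl
  ∑≡sum {suc k} f = cong (f zero +_) (∑≡sum (λ i → f (suc i)))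

  geometry-dot : ∀ c x → Geometry.dot F N c x ≡ dot c x
  geometry-dot c x = ∑≡sum (λ i → c i * x i)

  nonZero? : (x : V) → Dec (NonZero x)
  nonZero? x = ¬? (all? (λ i → x i ≟ 0#))

  u-nonZero : (ℓ : Line) → NonZero (u ℓ)
  u-nonZero ℓ u≡0 = 1≢0 (proj₁ (independent ℓ 1# 0# (λ i → begin
    1# * u ℓ i + 0# * v ℓ i  ≡⟨ cong₂ _+_ (*-identityˡ _) (zeroˡ _) ⟩
    u ℓ i + 0#               ≡⟨ +-identityʳ _ ⟩
    u ℓ i                    ≡⟨ u≡0 i ⟩
    0#                       ∎)))

  u∈ℓ : (ℓ : Line) → InSpan ℓ (u ℓ)
  u∈ℓ ℓ = 1# , 0# , λ i → sym (begin
    1# * u ℓ i + 0# * v ℓ i  ≡⟨ cong₂ _+_ (*-identityˡ _) (zeroˡ _) ⟩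
    u ℓ i + 0#               ≡⟨ +-identityʳ _ ⟩
    u ℓ i                    ∎)

  dot-span : ∀ c ℓ {x} → ((a , b , _) : InSpan ℓ x) → dot c x ≡ a * dot c (u ℓ) + b * dot c (v ℓ)
  dot-span c ℓ (a , b , x≡ab) = trans (sum-cong-≗ (λ i → cong (c i *_) (x≡ab i)))
                                      (dot-linearʳ c a (u ℓ) b (v ℓ))

  span-coefficient-≢0 : ∀ ℓ {x} → NonZero x → ((a , b , _) : InSpan ℓ x) → ¬ a ≡ 0# ⊎ ¬ b ≡ 0#
  span-coefficient-≢0 ℓ {x} x≢0 (a , b , x≡ab) = ≢0⊎≢0 λ (a≡0 , b≡0) → x≢0 λ i → begin
    x i                      ≡⟨ x≡ab i ⟩
    a * u ℓ i + b * v ℓ i    ≡⟨ cong₂ (λ a b → a * u ℓ i + b * v ℓ i) a≡0 b≡0 ⟩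
    0# * u ℓ i + 0# * v ℓ i  ≡⟨ cong₂ _+_ (zeroˡ _) (zeroˡ _) ⟩
    0# + 0#                  ≡⟨ +-identityʳ 0# ⟩
    0#                       ∎

  LineIn : V → Line → Set
  LineIn c ℓ = dot c (u ℓ) ≡ 0# × dot c (v ℓ) ≡ 0#

  lineIn? : ∀ c ℓ → Dec (LineIn c ℓ)
  lineIn? c ℓ = (dot c (u ℓ) ≟ 0#) ×-dec (dot c (v ℓ) ≟ 0#)

  LineIn⇒dot≡0 : ∀ c ℓ {x} → LineIn c ℓ → InSpan ℓ x → dot c x ≡ 0#
  LineIn⇒dot≡0 c ℓ {x} (cu≡0 , cv≡0) (a , b , x≡ab) = begin
    dot c x                            ≡⟨ dot-span c ℓ (a , b , x≡ab) ⟩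
    a * dot c (u ℓ) + b * dot c (v ℓ)  ≡⟨ cong₂ (λ p r → a * p + b * r) cu≡0 cv≡0 ⟩
    a * 0# + b * 0#                    ≡⟨ cong₂ _+_ (zeroʳ a) (zeroʳ b) ⟩
    0# + 0#                            ≡⟨ +-identityʳ 0# ⟩
    0#                                 ∎

  -- The point where ℓ meets the hyperplane c·x = 0 (the zero vector when ℓ lies in it).
  trace : V → Line → V
  trace c ℓ i = dot c (v ℓ) * u ℓ i + (- dot c (u ℓ)) * v ℓ i

  trace∈ℓ : ∀ c ℓ → InSpan ℓ (trace c ℓ)
  trace∈ℓ c ℓ = _ , _ , λ i → refl

  dot-trace : ∀ c ℓ → dot c (trace c ℓ) ≡ 0#
  dot-trace c ℓ = trans (dot-span c ℓ (trace∈ℓ c ℓ)) (x*y-y*x≡0 (dot c (v ℓ)) (dot c (u ℓ)))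

  trace≡0⇒LineIn : ∀ c ℓ → ¬ NonZero (trace c ℓ) → LineIn c ℓ
  trace≡0⇒LineIn c ℓ trace≡0 = -x≡0⇒x≡0 (proj₂ coefficients≡0) , proj₁ coefficients≡0
    where
    coefficients≡0 = independent ℓ _ _ (decidable-stable (all? (λ i → trace c ℓ i ≟ 0#)) trace≡0)

  Meet-sym : ∀ ℓ m → Meet ℓ m → Meet m ℓ
  Meet-sym _ _ (x , x≠0 , x∈ℓ , x∈m) = x , x≠0 , x∈m , x∈ℓ

  InAxis : V → V → V → Set
  InAxis c₁ c₂ x = dot c₁ x ≡ 0# × dot c₂ x ≡ 0#

  MeetsAxis : V → V → Line → Set
  MeetsAxis c₁ c₂ ℓ = Σ V λ x → NonZero x × InSpan ℓ x × InAxis c₁ c₂ x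

  LineIn⇒MeetsAxis : ∀ c₁ c₂ ℓ → LineIn c₁ ℓ → MeetsAxis c₁ c₂ ℓ
  LineIn⇒MeetsAxis c₁ c₂ ℓ ℓ⊆c₁ with nonZero? (trace c₂ ℓ)
  ... | yes t≠0 = trace c₂ ℓ , t≠0 , trace∈ℓ c₂ ℓ ,
                  LineIn⇒dot≡0 c₁ ℓ ℓ⊆c₁ (trace∈ℓ c₂ ℓ) , dot-trace c₂ ℓ
  ... | no t≡0  = u ℓ , u-nonZero ℓ , u∈ℓ ℓ , proj₁ ℓ⊆c₁ , proj₁ (trace≡0⇒LineIn c₂ ℓ t≡0)

  trace⇒MeetsAxis : ∀ c₁ c₂ ℓ → dot c₂ (trace c₁ ℓ) ≡ 0# → MeetsAxis c₁ c₂ ℓ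
  trace⇒MeetsAxis c₁ c₂ ℓ c₂t≡0 with nonZero? (trace c₁ ℓ)
  ... | yes t≠0 = trace c₁ ℓ , t≠0 , trace∈ℓ c₁ ℓ , dot-trace c₁ ℓ , c₂t≡0
  ... | no t≡0  = LineIn⇒MeetsAxis c₁ c₂ ℓ (trace≡0⇒LineIn c₁ ℓ t≡0)

  spanning-partner : ∀ ℓ {P} → NonZero P → InSpan ℓ P →
                     Σ V λ w → ∀ c → dot c P ≡ 0# → dot c w ≡ 0# → LineIn c ℓ
  spanning-partner ℓ {P} P≠0 P∈ℓ@(a , b , _) with span-coefficient-≢0 ℓ P≠0 P∈ℓ
  ... | inj₁ a≢0 = v ℓ , λ c cP≡0 cv≡0 → x*y≡0⇒x≡0 a≢0 (begin
    dot c (u ℓ) * a                    ≡⟨ *-comm _ a ⟩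
    a * dot c (u ℓ)                    ≡⟨ +-identityʳ _ ⟨
    a * dot c (u ℓ) + 0#               ≡⟨ cong (a * dot c (u ℓ) +_) (trans (cong (b *_) cv≡0) (zeroʳ b)) ⟨
    a * dot c (u ℓ) + b * dot c (v ℓ)  ≡⟨ dot-span c ℓ P∈ℓ ⟨
    dot c P                            ≡⟨ cP≡0 ⟩
    0#                                 ∎) , cv≡0
  ... | inj₂ b≢0 = u ℓ , λ c cP≡0 cu≡0 → cu≡0 , x*y≡0⇒x≡0 b≢0 (begin
    dot c (v ℓ) * b                    ≡⟨ *-comm _ b ⟩
    b * dot c (v ℓ)                    ≡⟨ +-identityˡ _ ⟨
    0# + b * dot c (v ℓ)               ≡⟨ cong (_+ b * dot c (v ℓ)) (trans (cong (a *_) cu≡0) (zeroʳ a)) ⟨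
    a * dot c (u ℓ) + b * dot c (v ℓ)  ≡⟨ dot-span c ℓ P∈ℓ ⟨
    dot c P                            ≡⟨ cP≡0 ⟩
    0#                                 ∎)

  record Independent (a b : V) : Set where
    constructor minor≢0
    field
      {k l} : Fin (suc N)
      minor-nonzero : ¬ a k * b l ≡ a l * b k

  Independent-shear : ∀ {a b} t → Independent a b → Independent (λ i → b i + t * a i) a
  Independent-shear {a} {b} t (minor≢0 {k} {l} ind) = minor≢0 λ eq → ind (begin
    a k * b l  ≡⟨ *-comm (a k) (b l) ⟩
    b l * a k  ≡⟨ +-cancelʳ (t * (a k * a l)) _ _ (begin
      b l * a k + t * (a k * a l)  ≡⟨ solve 4 (λ bl ak t al → bl :* ak :+ t :* (ak :* al) := (bl :+ t :* al) :* ak)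
                                              refl (b l) (a k) t (a l) ⟩
      (b l + t * a l) * a k        ≡⟨ eq ⟨
      (b k + t * a k) * a l        ≡⟨ solve 4 (λ bk ak t al → (bk :+ t :* ak) :* al := bk :* al :+ t :* (ak :* al))
                                              refl (b k) (a k) t (a l) ⟩
      b k * a l + t * (a k * a l)  ∎) ⟩
    b k * a l  ≡⟨ *-comm (b k) (a l) ⟩
    a l * b k  ∎)

  Independent⇒NonZero : ∀ {a b} → Independent a b → NonZero a
  Independent⇒NonZero {a} {b} (minor≢0 {k} {l} ind) a≡0 = ind (begin
    a k * b l  ≡⟨ cong (_* b l) (a≡0 k) ⟩
    0# * b l   ≡⟨ zeroˡ (b l) ⟩
    0#         ≡⟨ zeroˡ (b k) ⟨
    0# * b k   ≡⟨ cong (_* b k) (a≡0 l) ⟨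
    a l * b k  ∎)

  separating-point : ∀ {g c} → Independent g c → Σ V λ y → dot g y ≡ 0# × ¬ dot c y ≡ 0#
  separating-point {g} {c} (minor≢0 {k} {l} ind) = y , gy≡0 , cy≢0
    where
    y : V
    y i = g k * δ l i + (- g l) * δ k i

    dot-y : ∀ d → dot d y ≡ g k * d l + (- g l) * d k
    dot-y d = trans (dot-linearʳ d (g k) (δ l) (- g l) (δ k))
                    (cong₂ (λ p s → g k * p + (- g l) * s) (dot-δ d l) (dot-δ d k))

    gy≡0 : dot g y ≡ 0#
    gy≡0 = trans (dot-y g) (x*y-y*x≡0 (g k) (g l))

    cy≢0 : ¬ dot c y ≡ 0#
    cy≢0 cy≡0 = ind (x-y*z≡0⇒x≡y*z (trans (sym (dot-y c)) cy≡0))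

module PencilArgument (F : Field) (_≟_ : DecidableEquality (Field.Carrier F)) (N : ℕ)
                      {q : ℕ} (enumeration : Fin q ↔ Field.Carrier F) where
  open LinearAlgebra F _≟_
  open LinesAndAxes F _≟_ N
  open Geometry F N using (V; Line; NonZero; Covered; HiggledyPiggledy)
  open ≡-Reasoning

  scalar : Fin q → Carrier
  scalar = Inverse.to enumeration

  module _ (c₁ c₂ : V) where

    -- The q + 1 hyperplanes through the axis c₁·x = c₂·x = 0.
    pencil : Fin (suc q) → V
    pencil zero    = c₁
    pencil (suc a) i = c₂ i + scalar a * c₁ i

    InAxis⇒in-pencil : ∀ a x → InAxis c₁ c₂ x → dot (pencil a) x ≡ 0#
    InAxis⇒in-pencil zero    _ (c₁x≡0 , _) = c₁x≡0
    InAxis⇒in-pencil (suc a) x (c₁x≡0 , c₂x≡0) = begin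
      dot (pencil (suc a)) x          ≡⟨ dot-+*ˡ c₂ (scalar a) c₁ x ⟩
      dot c₂ x + scalar a * dot c₁ x  ≡⟨ cong₂ (λ p r → p + scalar a * r) c₂x≡0 c₁x≡0 ⟩
      0# + scalar a * 0#              ≡⟨ trans (+-identityˡ _) (zeroʳ _) ⟩
      0#                              ∎

    c₂-vanishes : ∀ a x → dot c₁ x ≡ 0# → dot (pencil (suc a)) x ≡ 0# → dot c₂ x ≡ 0#
    c₂-vanishes a x c₁x≡0 ax≡0 = begin
      dot c₂ x                        ≡⟨ +-identityʳ _ ⟨
      dot c₂ x + 0#                   ≡⟨ cong (dot c₂ x +_) (trans (cong (scalar a *_) c₁x≡0) (zeroʳ _)) ⟨
      dot c₂ x + scalar a * dot c₁ x  ≡⟨ dot-+*ˡ c₂ (scalar a) c₁ x ⟨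
      dot (pencil (suc a)) x          ≡⟨ ax≡0 ⟩
      0#                              ∎

    pencil-∩ : ∀ {a b} → ¬ a ≡ b → ∀ x → dot (pencil a) x ≡ 0# → dot (pencil b) x ≡ 0# → InAxis c₁ c₂ x
    pencil-∩ {zero}  {zero}  a≢b = contradiction refl a≢b
    pencil-∩ {zero}  {suc b} _   x c₁x≡0 bx≡0 = c₁x≡0 , c₂-vanishes b x c₁x≡0 bx≡0
    pencil-∩ {suc a} {zero}  _   x ax≡0 c₁x≡0 = c₁x≡0 , c₂-vanishes a x c₁x≡0 ax≡0
    pencil-∩ {suc a} {suc b} a≢b x ax≡0 bx≡0 = c₁x≡0 , c₂-vanishes a x c₁x≡0 ax≡0
      where
      c₁x≡0 : dot c₁ x ≡ 0#
      c₁x≡0 with dot c₁ x ≟ 0#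
      ... | yes c₁x≡0 = c₁x≡0
      ... | no  c₁x≢0 = contradiction (Injection.injective (↔⇒↣ enumeration) (*-cancelʳ-≢0 _ c₁x≢0 ta≡tb))
                                      (a≢b ∘ cong suc)
        where
        ta≡tb : scalar a * dot c₁ x ≡ scalar b * dot c₁ x
        ta≡tb = +-cancelˡ (dot c₂ x) _ _ (begin
          dot c₂ x + scalar a * dot c₁ x  ≡⟨ dot-+*ˡ c₂ (scalar a) c₁ x ⟨
          dot (pencil (suc a)) x          ≡⟨ ax≡0 ⟩
          0#                              ≡⟨ bx≡0 ⟨
          dot (pencil (suc b)) x          ≡⟨ dot-+*ˡ c₂ (scalar b) c₁ x ⟩
          dot c₂ x + scalar b * dot c₁ x  ∎)

    module _ (ind : Independent c₁ c₂) where

      pencil-nonZero : ∀ a → NonZero (pencil a)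
      pencil-nonZero zero    = Independent⇒NonZero ind
      pencil-nonZero (suc a) = Independent⇒NonZero (Independent-shear (scalar a) ind)

      off-axis-point : ∀ a → Σ V λ y → dot (pencil a) y ≡ 0# × ¬ InAxis c₁ c₂ y
      off-axis-point zero with separating-point ind
      ... | y , c₁y≡0 , c₂y≢0 = y , c₁y≡0 , c₂y≢0 ∘ proj₂
      off-axis-point (suc a) with separating-point (Independent-shear (scalar a) ind)
      ... | y , ay≡0 , c₁y≢0 = y , ay≡0 , c₁y≢0 ∘ proj₁

    LineInAxis : Line → Set
    LineInAxis ℓ = LineIn c₁ ℓ × LineIn c₂ ℓ

    Stray : Fin (suc q) → Line → Set
    Stray a ℓ = LineIn (pencil a) ℓ × ¬ LineInAxis ℓ

    stray-unique : ∀ {a b} ℓ → Stray a ℓ → Stray b ℓ → a ≡ b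
    stray-unique {a} {b} ℓ (ℓ⊆a , ℓ⊈axis) (ℓ⊆b , _) with a Fin.≟ b
    ... | yes a≡b = a≡b
    ... | no  a≢b = ⊥-elim (ℓ⊈axis ((proj₁ u∈axis , proj₁ v∈axis) , (proj₂ u∈axis , proj₂ v∈axis)))
      where
      u∈axis = pencil-∩ a≢b (Line.u ℓ) (proj₁ ℓ⊆a) (proj₁ ℓ⊆b)
      v∈axis = pencil-∩ a≢b (Line.v ℓ) (proj₂ ℓ⊆a) (proj₂ ℓ⊆b)

    stray? : ∀ a ℓ → Dec (Stray a ℓ)
    stray? a ℓ = lineIn? (pencil a) ℓ ×-dec ¬? (lineIn? c₁ ℓ ×-dec lineIn? c₂ ℓ)

    module _ {M} (L : Fin M → Line) where

      Free : Fin (suc q) → Set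
      Free a = ∀ x → ¬ Stray a (L x)

      -- More members than lines: two members would share a stray line, which forces it into the axis.
      free-member : M ℕ.≤ q → ∃ Free
      free-member M≤q with any? (λ a → all? (λ x → ¬? (stray? a (L x))))
      ... | yes free = free
      ... | no ¬free = ⊥-elim (<⇒≢ a<b (stray-unique (L (proj₁ (stray-of b)))
                                                    (subst (Stray a ∘ L) La≡Lb (proj₂ (stray-of a)))
                                                    (proj₂ (stray-of b))))
        where
        stray-of : ∀ a → ∃ λ x → Stray a (L x)
        stray-of a = decidable-stable (any? (λ x → stray? a (L x)))
                                      λ ¬stray → ¬free (a , λ x s → ¬stray (x , s))
        pigeons = pigeonhole (ℕ.s≤s M≤q) (proj₁ ∘ stray-of)
        a = proj₁ pigeons
        b = proj₁ (proj₂ pigeons)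
        a<b = proj₁ (proj₂ (proj₂ pigeons))
        La≡Lb = proj₂ (proj₂ (proj₂ pigeons))

      module _ (transversal : ∀ x → MeetsAxis c₁ c₂ (L x)) where

        -- A line not contained in a hyperplane of the pencil meets it in a single point, which is
        -- therefore the line's point on the axis.
        covered⇒InAxis : ∀ {a} → Free a → ∀ {w} → Covered L w → dot (pencil a) w ≡ 0# → InAxis c₁ c₂ w
        covered⇒InAxis {a} free {w} (_ , x , w∈ℓ) gw≡0 with lineIn? (pencil a) (L x)
        ... | yes ℓ⊆g = LineIn⇒dot≡0 c₁ (L x) (proj₁ ℓ⊆axis) w∈ℓ , LineIn⇒dot≡0 c₂ (L x) (proj₂ ℓ⊆axis) w∈ℓ
          where
          ℓ⊆axis : LineInAxis (L x)
          ℓ⊆axis = decidable-stable (lineIn? c₁ (L x) ×-dec lineIn? c₂ (L x))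
                                    (λ ℓ⊈axis → free x (ℓ⊆g , ℓ⊈axis))
        ... | no ℓ⊈g with transversal x
        ...   | P , P≠0 , P∈ℓ , P∈axis = annihilated c₁ (proj₁ P∈axis) , annihilated c₂ (proj₂ P∈axis)
          where
          ℓ = L x
          g = pencil a
          w∝P = proportional (≢0⊎≢0 ℓ⊈g) (trans (sym (dot-span g ℓ w∈ℓ)) gw≡0)
                                         (trans (sym (dot-span g ℓ P∈ℓ)) (InAxis⇒in-pencil a P P∈axis))
          annihilated : ∀ c → dot c P ≡ 0# → dot c w ≡ 0#
          annihilated c cP≡0 = trans (dot-span c ℓ w∈ℓ)
            (proportional-annihilated w∝P (span-coefficient-≢0 ℓ P≠0 P∈ℓ) (trans (sym (dot-span c ℓ P∈ℓ)) cP≡0))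

        no-transversal-axis : HiggledyPiggledy L → M ℕ.≤ q → ¬ Independent c₁ c₂
        no-transversal-axis hp M≤q ind with free-member M≤q
        ... | a , free with off-axis-point ind a
        ...   | y , gy≡0 , y∉axis with hp (pencil a) (pencil-nonZero ind a) y (trans (geometry-dot (pencil a) y) gy≡0)
        ...     | _ , w , w-covered , λs , y≡∑ =
          y∉axis (span-in-axis c₁ (λ _ → proj₁) , span-in-axis c₂ (λ _ → proj₂))
          where
          w∈axis : ∀ j → InAxis c₁ c₂ (w j)
          w∈axis j = covered⇒InAxis {a} free (proj₁ (w-covered j))
                                    (trans (sym (geometry-dot (pencil a) (w j))) (proj₂ (w-covered j)))
          span-in-axis : ∀ c → (∀ x → InAxis c₁ c₂ x → dot c x ≡ 0#) → dot c y ≡ 0#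
          span-in-axis c select =
            trans (sum-cong-≗ (λ i → cong (c i *_) (trans (y≡∑ i) (∑≡sum (λ j → λs j * w j i)))))
                  (dot-vanishes-on-span c λs w (λ j → select (w j) (w∈axis j)))

complement : ∀ {d m} n → d ℕ.+ n ≡ m → (ps : Fin d → Fin m) → Injective _≡_ _≡_ ps →
             Σ (Fin n → Fin m) λ rest → ∀ x → (∃ λ t → ps t ≡ x) ⊎ (∃ λ y → rest y ≡ x)
complement {zero}  n refl ps _ = id , λ x → inj₂ (x , refl)
complement {suc d} n refl ps ps-injective = Fin.punchIn p ∘ rest , cover
  where
  p = ps zero
  p≢ps : ∀ t → ¬ p ≡ ps (suc t)
  p≢ps t p≡ps = 0≢1+n (ps-injective p≡ps)
  ps′ : Fin d → Fin (d ℕ.+ n)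
  ps′ t = Fin.punchOut (p≢ps t)
  ps′-injective : Injective _≡_ _≡_ ps′
  ps′-injective eq = suc-injective (ps-injective (punchOut-injective (p≢ps _) (p≢ps _) eq))
  complement′ = complement n refl ps′ ps′-injective
  rest = proj₁ complement′

  cover : ∀ x → (∃ λ t → ps t ≡ x) ⊎ (∃ λ y → Fin.punchIn p (rest y) ≡ x)
  cover x with p Fin.≟ x
  ... | yes refl = inj₁ (zero , refl)
  ... | no  p≢x with proj₂ complement′ (Fin.punchOut p≢x)
  ...   | inj₁ (t , ps′t≡x′) = inj₁ (suc t , (begin
    ps (suc t)                         ≡⟨ punchIn-punchOut (p≢ps t) ⟨
    Fin.punchIn p (ps′ t)              ≡⟨ cong (Fin.punchIn p) ps′t≡x′ ⟩
    Fin.punchIn p (Fin.punchOut p≢x)   ≡⟨ punchIn-punchOut p≢x ⟩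
    x                                  ∎))
    where open ≡-Reasoning
  ...   | inj₂ (y , resty≡x′) = inj₂ (y , trans (cong (Fin.punchIn p) resty≡x′) (punchIn-punchOut p≢x))

module Sizes where
  open import Data.Nat using (_+_; _*_; _≤_)
  open import Data.Nat.Properties using (≤-reflexive)
  open import Data.Nat.Tactic.RingSolver using (solve-∀)

  odd-sizes : ∀ {N M} h → N ≡ 1 + suc h * 2 → M ≡ N + suc h →
              2 + (suc h + (1 + h * 2)) ≡ M × 1 + (suc h + suc h) ≤ N × suc (1 + (1 + h * 2)) ≤ N
  odd-sizes h refl refl = lines h , ≤-reflexive (room₁ h) , ≤-reflexive (room₂ h)
    where
    lines : ∀ h → 2 + (suc h + (1 + h * 2)) ≡ 1 + suc h * 2 + suc h
    lines = solve-∀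
    room₁ : ∀ h → 1 + (suc h + suc h) ≡ 1 + suc h * 2
    room₁ = solve-∀
    room₂ : ∀ h → suc (1 + (1 + h * 2)) ≡ 1 + suc h * 2
    room₂ = solve-∀

  two-pairs-sizes : ∀ {N M} h → N ≡ suc (suc h) * 2 → M ≡ N + suc (suc h) →
                    4 + (suc h + (1 + h * 2)) ≡ M × 2 + (suc h + suc h) ≤ N × suc (2 + (1 + h * 2)) ≤ N
  two-pairs-sizes h refl refl = lines h , ≤-reflexive (room₁ h) , ≤-reflexive (room₂ h)
    where
    lines : ∀ h → 4 + (suc h + (1 + h * 2)) ≡ suc (suc h) * 2 + suc (suc h)
    lines = solve-∀
    room₁ : ∀ h → 2 + (suc h + suc h) ≡ suc (suc h) * 2
    room₁ = solve-∀
    room₂ : ∀ h → suc (2 + (1 + h * 2)) ≡ suc (suc h) * 2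
    room₂ = solve-∀

  three-lines-sizes : ∀ {N M} h → N ≡ suc (suc h) * 2 → M ≡ N + suc (suc h) →
                      3 + (h + (3 + h * 2)) ≡ M × 4 + (h + h) ≤ N × suc (0 + (3 + h * 2)) ≤ N
  three-lines-sizes h refl refl = lines h , ≤-reflexive (room₁ h) , ≤-reflexive (room₂ h)
    where
    lines : ∀ h → 3 + (h + (3 + h * 2)) ≡ suc (suc h) * 2 + suc (suc h)
    lines = solve-∀
    room₁ : ∀ h → 4 + (h + h) ≡ suc (suc h) * 2
    room₁ = solve-∀
    room₂ : ∀ h → suc (0 + (3 + h * 2)) ≡ suc (suc h) * 2
    room₂ = solve-∀

module Configurations (F : Field) (_≟_ : DecidableEquality (Field.Carrier F)) (N : ℕ)
                      {q : ℕ} (enumeration : Fin q ↔ Field.Carrier F)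
                      {M : ℕ} (L : Fin M → Geometry.Line F N)
                      (hp : Geometry.HiggledyPiggledy F N L) (M≤q : M ℕ.≤ q) where
  open LinearAlgebra F _≟_
  open LinesAndAxes F _≟_ N
  open PencilArgument F _≟_ N enumeration
  open Geometry F N using (V; Line; InSpan; Meet)
  open Line
  open Sizes

  Annihilates : ∀ {e} → V → (Fin e → V) → Set
  Annihilates c = All (λ x → dot c x ≡ 0#)

  -- c₂ also vanishes at a coordinate where c₁ does not, which makes the pair independent.
  independent-annihilators : ∀ {a b} (A : Fin a → V) (B : V → Fin b → V) → a ℕ.≤ N → suc b ℕ.≤ N →
    Σ V λ c₁ → Σ V λ c₂ → Annihilates c₁ A × Annihilates c₂ (B c₁) × Independent c₁ c₂
  independent-annihilators A B a≤N b<N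
    with homogeneous-nontrivial a≤N A
  ... | c₁ , (k , c₁k≢0) , Ac₁≡0
    with homogeneous-nontrivial b<N (λ { zero → δ k ; (suc r) → B c₁ r })
  ... | c₂ , (l , c₂l≢0) , Bc₂≡0 =
    c₁ , c₂ ,
    (λ r → trans (dot-comm c₁ (A r)) (Ac₁≡0 r)) ,
    (λ r → trans (dot-comm c₂ (B c₁ r)) (Bc₂≡0 (suc r))) ,
    minor≢0 λ eq → *-≢0 c₁k≢0 c₂l≢0 (trans eq (trans (cong (c₁ l *_) c₂k≡0) (zeroʳ (c₁ l))))
    where
    c₂k≡0 : c₂ k ≡ 0#
    c₂k≡0 = trans (sym (dot-δ c₂ k)) (trans (dot-comm c₂ (δ k)) (Bc₂≡0 zero))

  -- The lines other than the specials are split into s lines placed inside the hyperplane c₁ (two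
  -- conditions each) and r lines whose traces on c₁ are placed inside c₂ (one condition each).
  no-axis-recipe : ∀ {d e₁ e₂} s r → d ℕ.+ (s ℕ.+ r) ≡ M → e₁ ℕ.+ (s ℕ.+ s) ℕ.≤ N → suc (e₂ ℕ.+ r) ℕ.≤ N →
    (specials : Vec (Fin M) d) → Unique specials → (A : Fin e₁ → V) (B : V → Fin e₂ → V) →
    ¬ (∀ c₁ c₂ → Annihilates c₁ A → Annihilates c₂ (B c₁) → ∀ t → MeetsAxis c₁ c₂ (L (lookup specials t)))
  no-axis-recipe s r d+s+r≡M e₁+2s≤N e₂+r<N specials distinct A B recipe =
    no-transversal-axis c₁ c₂ L transversal hp M≤q c₁-c₂-independent
    where
    rest = complement (s ℕ.+ r) d+s+r≡M (lookup specials) (lookup-injective distinct _ _)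

    inside : Fin s → Line
    inside y = L (proj₁ rest (y ↑ˡ r))

    cut : Fin r → Line
    cut y = L (proj₁ rest (s ↑ʳ y))

    axis = independent-annihilators (A ++ (u ∘ inside) ++ (v ∘ inside))
                                    (λ c₁ → B c₁ ++ (λ y → trace c₁ (cut y))) e₁+2s≤N e₂+r<N
    c₁ = proj₁ axis
    c₂ = proj₁ (proj₂ axis)
    c₁-c₂-independent = proj₂ (proj₂ (proj₂ (proj₂ axis)))
    c₁-conditions = ++⁻ (λ x → dot c₁ x ≡ 0#) A (proj₁ (proj₂ (proj₂ axis)))
    c₁-inside = ++⁻ (λ x → dot c₁ x ≡ 0#) (u ∘ inside) (proj₂ c₁-conditions)
    c₂-conditions = ++⁻ (λ x → dot c₂ x ≡ 0#) (B c₁) (proj₁ (proj₂ (proj₂ (proj₂ axis))))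

    transversal : ∀ x → MeetsAxis c₁ c₂ (L x)
    transversal x with proj₂ rest x
    ... | inj₁ (t , refl) = recipe c₁ c₂ (proj₁ c₁-conditions) (proj₁ c₂-conditions) t
    ... | inj₂ (y , refl) with Fin.splitAt s y | join-splitAt s r y
    ...   | inj₁ y′ | refl = LineIn⇒MeetsAxis c₁ c₂ (inside y′) (proj₁ c₁-inside y′ , proj₂ c₁-inside y′)
    ...   | inj₂ y′ | refl = trace⇒MeetsAxis c₁ c₂ (cut y′) (proj₂ c₂-conditions y′)

  no-meeting-pair : ∀ s r → 2 ℕ.+ (s ℕ.+ r) ≡ M → 1 ℕ.+ (s ℕ.+ s) ℕ.≤ N → suc (1 ℕ.+ r) ℕ.≤ N →
                    ∀ {i j} → ¬ i ≡ j → ¬ Meet (L i) (L j)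
  no-meeting-pair s r size room₁ room₂ {i} {j} i≢j (P , P≠0 , P∈i , P∈j) =
    no-axis-recipe s r size room₁ room₂ (i ∷ j ∷ []) ((i≢j ∷ []) ∷ [] ∷ [])
                   (lookup (P ∷ [])) (λ _ → lookup (P ∷ [])) through-P
    where
    through-P : ∀ c₁ c₂ → Annihilates c₁ (lookup (P ∷ [])) → Annihilates c₂ (lookup (P ∷ [])) →
                ∀ t → MeetsAxis c₁ c₂ (L (lookup (i ∷ j ∷ []) t))
    through-P c₁ c₂ c₁P c₂P zero       = P , P≠0 , P∈i , c₁P zero , c₂P zero
    through-P c₁ c₂ c₁P c₂P (suc zero) = P , P≠0 , P∈j , c₁P zero , c₂P zero

  no-two-meeting-pairs : ∀ s r → 4 ℕ.+ (s ℕ.+ r) ≡ M → 2 ℕ.+ (s ℕ.+ s) ℕ.≤ N → suc (2 ℕ.+ r) ℕ.≤ N →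
                         ∀ {i j k l} → Unique (i ∷ j ∷ k ∷ l ∷ []) → Meet (L i) (L j) → ¬ Meet (L k) (L l)
  no-two-meeting-pairs s r size room₁ room₂ {i} {j} {k} {l} distinct (P , P≠0 , P∈i , P∈j)
                                                                      (Q , Q≠0 , Q∈k , Q∈l) =
    no-axis-recipe s r size room₁ room₂ (i ∷ j ∷ k ∷ l ∷ []) distinct
                   (lookup (P ∷ Q ∷ [])) (λ _ → lookup (P ∷ Q ∷ [])) through-P-and-Q
    where
    through-P-and-Q : ∀ c₁ c₂ → Annihilates c₁ (lookup (P ∷ Q ∷ [])) → Annihilates c₂ (lookup (P ∷ Q ∷ [])) →
                      ∀ t → MeetsAxis c₁ c₂ (L (lookup (i ∷ j ∷ k ∷ l ∷ []) t))
    through-P-and-Q c₁ c₂ c₁PQ c₂PQ zero                   = P , P≠0 , P∈i , c₁PQ zero , c₂PQ zero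
    through-P-and-Q c₁ c₂ c₁PQ c₂PQ (suc zero)             = P , P≠0 , P∈j , c₁PQ zero , c₂PQ zero
    through-P-and-Q c₁ c₂ c₁PQ c₂PQ (suc (suc zero))       = Q , Q≠0 , Q∈k , c₁PQ (suc zero) , c₂PQ (suc zero)
    through-P-and-Q c₁ c₂ c₁PQ c₂PQ (suc (suc (suc zero))) = Q , Q≠0 , Q∈l , c₁PQ (suc zero) , c₂PQ (suc zero)

  -- Here c₁ contains the whole of the three lines, costing only four conditions.
  no-line-meeting-two-others : ∀ s r → 3 ℕ.+ (s ℕ.+ r) ≡ M → 4 ℕ.+ (s ℕ.+ s) ℕ.≤ N → suc (0 ℕ.+ r) ℕ.≤ N →
                               ∀ {c a b} → Unique (c ∷ a ∷ b ∷ []) → Meet (L c) (L a) → ¬ Meet (L c) (L b)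
  no-line-meeting-two-others s r size room₁ room₂ {c} {a} {b} distinct (P , P≠0 , P∈c , P∈a)
                                                                        (Q , Q≠0 , Q∈c , Q∈b) =
    no-axis-recipe s r size room₁ room₂ (c ∷ a ∷ b ∷ []) distinct
                   spanners (λ _ → lookup []) containing
    where
    partner-a = spanning-partner (L a) P≠0 P∈a
    partner-b = spanning-partner (L b) Q≠0 Q∈b
    spanners = lookup (u (L c) ∷ v (L c) ∷ proj₁ partner-a ∷ proj₁ partner-b ∷ [])

    c-inside : ∀ c₁ → Annihilates c₁ spanners → LineIn c₁ (L c)
    c-inside c₁ c₁-spanners = c₁-spanners zero , c₁-spanners (suc zero)

    on-c : ∀ c₁ → Annihilates c₁ spanners → ∀ {x} → InSpan (L c) x → dot c₁ x ≡ 0#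
    on-c c₁ c₁-spanners = LineIn⇒dot≡0 c₁ (L c) (c-inside c₁ c₁-spanners)

    containing : ∀ c₁ c₂ → Annihilates c₁ spanners → Annihilates c₂ (lookup []) →
                 ∀ t → MeetsAxis c₁ c₂ (L (lookup (c ∷ a ∷ b ∷ []) t))
    containing c₁ c₂ c₁-spanners _ zero =
      LineIn⇒MeetsAxis c₁ c₂ (L c) (c-inside c₁ c₁-spanners)
    containing c₁ c₂ c₁-spanners _ (suc zero) =
      LineIn⇒MeetsAxis c₁ c₂ (L a) (proj₂ partner-a c₁ (on-c c₁ c₁-spanners P∈c) (c₁-spanners (suc (suc zero))))
    containing c₁ c₂ c₁-spanners _ (suc (suc zero)) =
      LineIn⇒MeetsAxis c₁ c₂ (L b) (proj₂ partner-b c₁ (on-c c₁ c₁-spanners Q∈c) (c₁-spanners (suc (suc (suc zero)))))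

  odd-disjoint : ∀ h → N ≡ 1 ℕ.+ h ℕ.* 2 → M ≡ N ℕ.+ h → ∀ i j → ¬ i ≡ j → ¬ Meet (L i) (L j)
  odd-disjoint zero    N≡1 M≡N i j i≢j _ = i≢j (Fin1-unique (trans M≡N (cong (ℕ._+ 0) N≡1)) i j)
    where
    Fin1-unique : ∀ {m} → m ≡ 1 → (i j : Fin m) → i ≡ j
    Fin1-unique refl zero zero = refl
  odd-disjoint (suc h) N≡ M≡ i j i≢j with odd-sizes h N≡ M≡
  ... | size , room₁ , room₂ = no-meeting-pair (suc h) (1 ℕ.+ h ℕ.* 2) size room₁ room₂ i≢j

  module _ h (N≡ : N ≡ suc (suc h) ℕ.* 2) (M≡ : M ≡ N ℕ.+ suc (suc h)) where

    no-three-lines : ∀ {c a b} → Unique (c ∷ a ∷ b ∷ []) → Meet (L c) (L a) → ¬ Meet (L c) (L b)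
    no-three-lines with three-lines-sizes h N≡ M≡
    ... | size , room₁ , room₂ = no-line-meeting-two-others h (3 ℕ.+ h ℕ.* 2) size room₁ room₂

    no-two-pairs : ∀ {i j k l} → Unique (i ∷ j ∷ k ∷ l ∷ []) → Meet (L i) (L j) → ¬ Meet (L k) (L l)
    no-two-pairs with two-pairs-sizes h N≡ M≡
    ... | size , room₁ , room₂ = no-two-meeting-pairs (suc h) (1 ℕ.+ h ℕ.* 2) size room₁ room₂

    meeting-pairs-coincide : ∀ i j k l → ¬ i ≡ j → ¬ k ≡ l → Meet (L i) (L j) → Meet (L k) (L l) →
                             (i ≡ k × j ≡ l) ⊎ (i ≡ l × j ≡ k)
    meeting-pairs-coincide i j k l i≢j k≢l ij kl with i Fin.≟ k | j Fin.≟ l | i Fin.≟ l | j Fin.≟ k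
    ... | yes i≡k | yes j≡l | _ | _ = inj₁ (i≡k , j≡l)
    ... | _ | _ | yes i≡l | yes j≡k = inj₂ (i≡l , j≡k)
    ... | yes refl | no j≢l | _ | _ =
      ⊥-elim (no-three-lines ((i≢j ∷ k≢l ∷ []) ∷ (j≢l ∷ []) ∷ [] ∷ []) ij kl)
    ... | no i≢k | yes refl | _ | _ =
      ⊥-elim (no-three-lines ((i≢j ∘ sym ∷ k≢l ∘ sym ∷ []) ∷ (i≢k ∷ []) ∷ [] ∷ [])
                             (Meet-sym (L i) (L j) ij) (Meet-sym (L k) (L l) kl))
    ... | no i≢k | no j≢l | yes refl | no j≢k =
      ⊥-elim (no-three-lines ((i≢j ∷ i≢k ∷ []) ∷ (j≢k ∷ []) ∷ [] ∷ []) ij (Meet-sym (L k) (L l) kl))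
    ... | no i≢k | no j≢l | no i≢l | yes refl =
      ⊥-elim (no-three-lines ((i≢j ∘ sym ∷ j≢l ∷ []) ∷ (i≢l ∷ []) ∷ [] ∷ []) (Meet-sym (L i) (L j) ij) kl)
    ... | no i≢k | no j≢l | no i≢l | no j≢k =
      ⊥-elim (no-two-pairs ((i≢j ∷ i≢k ∷ i≢l ∷ []) ∷ (j≢k ∷ j≢l ∷ []) ∷ (k≢l ∷ []) ∷ [] ∷ []) ij kl)

  even-one-meeting-pair : ∀ h → N ≡ h ℕ.* 2 → M ≡ N ℕ.+ h → 4 ℕ.≤ N →
    ∀ i j k l → ¬ i ≡ j → ¬ k ≡ l → Meet (L i) (L j) → Meet (L k) (L l) → (i ≡ k × j ≡ l) ⊎ (i ≡ l × j ≡ k)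
  even-one-meeting-pair zero          N≡ _  4≤N = contradiction (subst (4 ℕ.≤_) N≡ 4≤N) λ ()
  even-one-meeting-pair (suc zero)    N≡ _  4≤N = contradiction (subst (4 ℕ.≤_) N≡ 4≤N) λ { (ℕ.s≤s (ℕ.s≤s ())) }
  even-one-meeting-pair (suc (suc h)) N≡ M≡ _   = meeting-pairs-coincide h N≡ M≡

-- Opened only here, as these operators would clash with the field operations in the modules above.
open import Data.Nat using (ℕ; _+_; _*_; _≤_; _/_; _%_)
open import Data.Nat.DivMod using (m≡m%n+[m/n]*n)

mainTheorem14 : (N q : ℕ) → 1 ≤ N → IsPrimePower q →
    (F : Field) → Fin q ↔ Field.Carrier F →
    (L : Fin (N + N / 2) → Geometry.Line F N) →
    (∀ i j → ¬ i ≡ j → ¬ Geometry.SameLine F N (L i) (L j)) →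
    Geometry.HiggledyPiggledy F N L →
    N + N / 2 ≤ q →
    (N % 2 ≡ 1 → ∀ i j → ¬ i ≡ j → ¬ Geometry.Meet F N (L i) (L j)) ×
    (4 ≤ N → N % 2 ≡ 0 → ∀ i j k l → ¬ i ≡ j → ¬ k ≡ l →
      Geometry.Meet F N (L i) (L j) → Geometry.Meet F N (L k) (L l) →
      (i ≡ k × j ≡ l) ⊎ (i ≡ l × j ≡ k))
mainTheorem14 N q _ _ F enumeration L _ hp M≤q =
  (λ N%2≡1 → odd-disjoint (N / 2) (N≡ N%2≡1) refl) ,
  (λ 4≤N N%2≡0 → even-one-meeting-pair (N / 2) (N≡ N%2≡0) refl 4≤N)
  where
  open Configurations F (via-injection (↔⇒↣ (↔-sym enumeration)) Fin._≟_) N enumeration L hp M≤q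
  N≡ : ∀ {r} → N % 2 ≡ r → N ≡ r + N / 2 * 2
  N≡ N%2≡r = trans (m≡m%n+[m/n]*n N 2) (cong (_+ N / 2 * 2) N%2≡r)
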